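{- Let $F$ be a face of a triangulation $\Gamma$. Then: (1) a zigzag belongs to $\mathcal Z(F)$ if and only if it contains at least one edge of $F$; (2) if a zigzag belongs to $\mathcal Z(F)$, then so does the reversed zigzag; (3) $2\le|\mathcal Z(F)|\le 6$.
   Context: A triangulation is a connected simple finite graph embedded in a connected closed $2$-dimensional surface such that every face (closure of a component of the complement) is a closed $2$-disc with exactly three edges, every edge lies in exactly two distinct faces, and two distinct faces meet in an edge, a vertex, or not at all. Two distinct edges are adjacent if they share a vertex and lie in a common face. A zigzag is a sequence of edges $(e_i)_{i\in\mathbb N}$ with $e_i,e_{i+1}$ adjacent and the face containing $e_i,e_{i+1}$ distinct from the face containing $e_{i+1},e_{i+2}$, for all $i$; it is periodic and regarded as a cyclic sequence; written as a cyclic sequence of vertices, each passage through an edge has a direction (oriented edge). Its reverse is also a zigzag. For a face $F$ with vertices $a,b,c$, $\Omega(F)=\{ab,bc,ca,ac,cb,ba\}$ (oriented edges, $xy$ from $x$ to $y$) and $D_F=(ab,bc,ca)(ac,cb,ba)$. $\mathcal Z(F)$ is the set of all zigzags containing consecutive oriented edges $e,D_F(e)$ for some $e\in\Omega(F)$. -}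

module Defs where

open import Data.Nat using (ℕ; suc)
open import Data.Integer using (ℤ; +_; _+_; -_)
open import Data.Fin using (Fin)
open import Data.Product using (Σ; ∃; ∃₂; _×_; _,_; proj₁; proj₂)
open import Data.Sum using (_⊎_)
open import Relation.Binary.PropositionalEquality using (_≡_; _≢_)
open import Relation.Binary.Construct.Closure.ReflexiveTransitive using (Star)

-- A (combinatorial) surface triangulation with n vertices (Fin n) and
-- m faces; face f is given by its three vertices.
FaceData : ℕ → ℕ → Set
FaceData n m = Fin m → Fin n × Fin n × Fin n

module _ {n m : ℕ} (face : FaceData n m) where

  V : Set
  V = Fin n

  _∈F_ : V → Fin m → Set
  v ∈F f with face f
  ... | (a , b , c) = v ≡ a ⊎ v ≡ b ⊎ v ≡ c

  Adj : V → V → Set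
  Adj u v = u ≢ v × ∃ λ f → u ∈F f × v ∈F f

  LinkAdj : V → V → V → Set
  LinkAdj v x y = ∃ λ f → v ∈F f × x ∈F f × y ∈F f × v ≢ x × v ≢ y × x ≢ y

  record IsTriangulation : Set where
    field
      faceDistinctVertices : ∀ f → let (a , b , c) = face f in
                               a ≢ b × b ≢ c × a ≢ c
      -- distinct faces have distinct vertex sets (so two distinct faces
      -- meet in an edge, a vertex, or not at all)
      facesDetermined : ∀ f g → (∀ v → v ∈F f → v ∈F g) → f ≡ g
      edgeInTwoFaces : ∀ u v → Adj u v →
        ∃₂ λ f g → f ≢ g × (u ∈F f × v ∈F f) × (u ∈F g × v ∈F g) ×
                   (∀ h → u ∈F h → v ∈F h → h ≡ f ⊎ h ≡ g)
      connected : ∀ u v → Star Adj u v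
      -- closed surface: the link of every vertex is a single cycle
      -- (it is 2-regular by edgeInTwoFaces; here: connected)
      linkConnected : ∀ v x y → Adj v x → Adj v y → Star (LinkAdj v) x y

  -- Zigzags, written as bi-infinite periodic sequences of vertices
  -- x : ℤ → V; the i-th oriented edge is (x i , x (i+1)).
  Periodic : (ℤ → V) → Set
  Periodic x = ∃ λ (p : ℕ) → ∀ i → x (i + + suc p) ≡ x i

  ThreeOn : (ℤ → V) → ℤ → Fin m → Set
  ThreeOn x i f = x i ∈F f × x (i + + 1) ∈F f × x (i + + 2) ∈F f

  -- e_i = x_i x_{i+1} and e_{i+1} = x_{i+1} x_{i+2} are adjacent:
  -- distinct edges sharing a vertex and lying in a common face
  AdjacentAt : (ℤ → V) → ℤ → Set
  AdjacentAt x i = x i ≢ x (i + + 1) × x (i + + 1) ≢ x (i + + 2) ×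
                   x i ≢ x (i + + 2) × ∃ λ f → ThreeOn x i f

  IsZigzag : (ℤ → V) → Set
  IsZigzag x = Periodic x × (∀ i → AdjacentAt x i) ×
    (∀ i f g → ThreeOn x i f → ThreeOn x (i + + 1) g → f ≢ g)

  rev : (ℤ → V) → (ℤ → V)
  rev x i = x (- i)

  -- equality of zigzags as cyclic sequences: equal up to a shift
  SameZigzag : (ℤ → V) → (ℤ → V) → Set
  SameZigzag x y = ∃ λ k → ∀ i → y i ≡ x (i + k)

  _∈Ω_ : V × V → Fin m → Set
  e ∈Ω f = proj₁ e ∈F f × proj₂ e ∈F f × proj₁ e ≢ proj₂ e

  -- graph of D_F = (ab,bc,ca)(ac,cb,ba) for F = abc
  data DRel (a b c : V) : V × V → V × V → Set where
    ab↦bc : DRel a b c (a , b) (b , c)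
    bc↦ca : DRel a b c (b , c) (c , a)
    ca↦ab : DRel a b c (c , a) (a , b)
    ac↦cb : DRel a b c (a , c) (c , b)
    cb↦ba : DRel a b c (c , b) (b , a)
    ba↦ac : DRel a b c (b , a) (a , c)

  D : Fin m → V × V → V × V → Set
  D f with face f
  ... | (a , b , c) = DRel a b c

  -- x ∈ 𝒵(F): x contains consecutive oriented edges e, D_F(e), e ∈ Ω(F)
  InZ : Fin m → (ℤ → V) → Set
  InZ f x = ∃ λ i → (x i , x (i + + 1)) ∈Ω f ×
                    D f (x i , x (i + + 1)) (x (i + + 1) , x (i + + 2))

  ContainsEdgeOf : Fin m → (ℤ → V) → Set
  ContainsEdgeOf f x = ∃ λ i → (x i , x (i + + 1)) ∈Ω f

-- A zigzag is recorded by its consecutive vertex triples (xᵢ, xᵢ₊₁, xᵢ₊₂). Each is a flag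
-- (an ordering of the vertices of a face), and the next one is σ (a, b, c) = (b, c, d), where
-- d is the third vertex of the other face on the edge bc. Because σ ρ σ = ρ for the reversal
-- ρ (a, b, c) = (c, b, a), σ is injective on the finite set of flags. So its orbits are cycles,
-- and zigzags up to shift correspond exactly to these orbits. A zigzag lies in 𝒵(F) iff its
-- orbit contains one of the six orderings of F.
-- (1) If a zigzag passes through an edge pq of F, then one of the two faces holding the
--     consecutive flags (o, p, q) and (p, q, r) is F.
-- (2) ρ permutes the orderings of F and reverses zigzags.
-- (3) The six orderings give at most six orbits. Halfway along an orbit from t to ρ t one
--     would find a fixed point of ρ or a flag w with σ w = ρ w. So (a, b, c) and (c, b, a)
--     lie in different orbits.
module Submission where

open import Defs
open import Data.Nat using (ℕ; _≤_; zero; suc; _+_; _*_; _%_; _/_; z≤n; s≤s)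
import Data.Nat.Properties as ℕ
open import Data.Nat.DivMod using (m≡m%n+[m/n]*n; m%n<n)
open import Data.Integer using (ℤ; +_; -[1+_]; -_) renaming (_+_ to _+ℤ_)
import Data.Integer.Properties as ℤ
open import Data.Integer.Tactic.RingSolver using (solve-∀)
open import Data.Fin using (Fin; zero; suc; toℕ; fromℕ<; combine)
import Data.Fin.Properties as Fin
open import Data.Product using (Σ; ∃; _×_; _,_; proj₁; proj₂)
import Data.Product.Properties as Product
open import Data.Sum using (_⊎_; inj₁; inj₂)
open import Data.Empty using (⊥-elim)
open import Data.List using (List; []; _∷_; length; lookup; deduplicate)
open import Data.List.Relation.Unary.Any using (here; there; index)
open import Data.List.Relation.Unary.Any.Properties using (lookup-index)
import Data.List.Relation.Unary.All as All
open import Data.List.Relation.Unary.AllPairs using (_∷_)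
open import Data.List.Membership.Propositional.Properties using (∈-lookup)
open import Data.List.Properties using (length-deduplicate)
open import Function using (_∘_)
open import Function.Bundles using (_⇔_; mk⇔)
open import Function.Definitions using (Injective)
open import Relation.Nullary using (Dec; yes; no; ¬_; contradiction)
open import Relation.Nullary.Decidable using (_×-dec_; _⊎-dec_; ¬?)
open import Relation.Binary.Definitions using (DecidableEquality)
open import Relation.Binary.Bundles using (Setoid; DecSetoid)
open import Relation.Binary.PropositionalEquality
  using (_≡_; _≢_; refl; sym; trans; cong; cong₂; cong-app; subst; ≢-sym; module ≡-Reasoning)

two-valued-pigeonhole : ∀ {A : Set} {a b x y z : A} → x ≡ a ⊎ x ≡ b → y ≡ a ⊎ y ≡ b → z ≡ a ⊎ z ≡ b →
                        x ≡ y ⊎ y ≡ z ⊎ x ≡ z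
two-valued-pigeonhole (inj₁ refl) (inj₁ refl) _           = inj₁ refl
two-valued-pigeonhole (inj₂ refl) (inj₂ refl) _           = inj₁ refl
two-valued-pigeonhole (inj₁ refl) (inj₂ refl) (inj₁ refl) = inj₂ (inj₂ refl)
two-valued-pigeonhole (inj₂ refl) (inj₁ refl) (inj₂ refl) = inj₂ (inj₂ refl)
two-valued-pigeonhole (inj₁ refl) (inj₂ refl) (inj₂ refl) = inj₂ (inj₁ refl)
two-valued-pigeonhole (inj₂ refl) (inj₁ refl) (inj₁ refl) = inj₂ (inj₁ refl)

distinct-indices⇒2≤ : ∀ {k} (i j : Fin k) → i ≢ j → 2 ≤ k
distinct-indices⇒2≤ {suc (suc k)} _ _ _ = s≤s (s≤s z≤n)
distinct-indices⇒2≤ {suc zero} zero zero i≢j = contradiction refl i≢j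

module _ {a ℓ} (S : Setoid a ℓ) where

  open Setoid S using (_≈_) renaming (sym to ≈-sym)
  open import Data.List.Relation.Unary.Unique.Setoid S using (Unique)

  Unique⇒lookup-injective : ∀ {xs} → Unique xs → ∀ i j → lookup xs i ≈ lookup xs j → i ≡ j
  Unique⇒lookup-injective (_ ∷ _) zero zero _ = refl
  Unique⇒lookup-injective (x≉ ∷ _) zero (suc j) e =
    contradiction e (All.lookup x≉ (∈-lookup j))
  Unique⇒lookup-injective (x≉ ∷ _) (suc i) zero e =
    contradiction (≈-sym e) (All.lookup x≉ (∈-lookup i))
  Unique⇒lookup-injective (_ ∷ u) (suc i) (suc j) e = cong suc (Unique⇒lookup-injective u i j e)

module Iteration {A : Set} (f : A → A) where

  open import Function.Endo.Propositional A public using (_^_)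
  open import Function.Endo.Propositional A using (^-homo)
  open ≡-Reasoning

  ^-cong : ∀ {k l} s → k ≡ l → (f ^ k) s ≡ (f ^ l) s
  ^-cong s refl = refl

  ^-+ : ∀ k l s → (f ^ (k + l)) s ≡ (f ^ k) ((f ^ l) s)
  ^-+ k l s = cong-app (^-homo f k l) s

  Reach : A → A → Set
  Reach s t = ∃ λ r → (f ^ r) s ≡ t

  Reach-refl : ∀ {s} → Reach s s
  Reach-refl = 0 , refl

  Reach-trans : ∀ {s t u} → Reach s t → Reach t u → Reach s u
  Reach-trans {s} (r , refl) (r′ , refl) = r′ + r , ^-+ r′ r s

  Follows : (ℤ → A) → Set
  Follows X = ∀ i → X (i +ℤ + 1) ≡ f (X i)

  follows-^ : ∀ {X} → Follows X → ∀ i k → X (i +ℤ + k) ≡ (f ^ k) (X i)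
  follows-^ {X} _ i zero = cong X (ℤ.+-identityʳ i)
  follows-^ {X} follows i (suc k) = begin
    X (i +ℤ + suc k)        ≡⟨ cong (λ e → X (i +ℤ + e)) (ℕ.+-comm 1 k) ⟩
    X (i +ℤ (+ k +ℤ + 1))   ≡⟨ cong X (ℤ.+-assoc i (+ k) (+ 1)) ⟨
    X ((i +ℤ + k) +ℤ + 1)   ≡⟨ follows (i +ℤ + k) ⟩
    f (X (i +ℤ + k))        ≡⟨ cong f (follows-^ follows i k) ⟩
    (f ^ suc k) (X i)       ∎

  module Periodic {s : A} {q : ℕ} (period : (f ^ suc q) s ≡ s) where

    ^-period+ : ∀ k → (f ^ (suc q + k)) s ≡ (f ^ k) s
    ^-period+ k = begin
      (f ^ (suc q + k)) s     ≡⟨ ^-cong s (ℕ.+-comm (suc q) k) ⟩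
      (f ^ (k + suc q)) s     ≡⟨ ^-+ k (suc q) s ⟩
      (f ^ k) ((f ^ suc q) s) ≡⟨ cong (f ^ k) period ⟩
      (f ^ k) s               ∎

    ^-periods+ : ∀ l k → (f ^ (l * suc q + k)) s ≡ (f ^ k) s
    ^-periods+ zero k = refl
    ^-periods+ (suc l) k = begin
      (f ^ (suc l * suc q + k)) s       ≡⟨ ^-cong s (ℕ.+-assoc (suc q) (l * suc q) k) ⟩
      (f ^ (suc q + (l * suc q + k))) s ≡⟨ ^-period+ (l * suc q + k) ⟩
      (f ^ (l * suc q + k)) s           ≡⟨ ^-periods+ l k ⟩
      (f ^ k) s                         ∎

    ^-mod : ∀ r → (f ^ (r % suc q)) s ≡ (f ^ r) s
    ^-mod r = begin
      (f ^ (r % suc q)) s                     ≡⟨ ^-periods+ (r / suc q) (r % suc q) ⟨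
      (f ^ (r / suc q * suc q + r % suc q)) s ≡⟨ ^-cong s (ℕ.+-comm (r / suc q * suc q) (r % suc q)) ⟩
      (f ^ (r % suc q + r / suc q * suc q)) s ≡⟨ ^-cong s (m≡m%n+[m/n]*n r (suc q)) ⟨
      (f ^ r) s                               ∎

    Reach-sym : ∀ {t} → Reach s t → Reach t s
    Reach-sym (r , refl) = r * q , (begin
      (f ^ (r * q)) ((f ^ r) s) ≡⟨ ^-+ (r * q) r s ⟨
      (f ^ (r * q + r)) s       ≡⟨ ^-cong s (ℕ.+-comm (r * q) r) ⟩
      (f ^ (r + r * q)) s       ≡⟨ ^-cong s (ℕ.*-suc r q) ⟨
      (f ^ (r * suc q)) s       ≡⟨ ^-cong s (ℕ.+-identityʳ (r * suc q)) ⟨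
      (f ^ (r * suc q + 0)) s   ≡⟨ ^-periods+ r 0 ⟩
      s                         ∎)

    Reach? : DecidableEquality A → ∀ t → Dec (Reach s t)
    Reach? _≟_ t with Fin.any? (λ (r : Fin (suc q)) → (f ^ toℕ r) s ≟ t)
    ... | yes (r , e) = yes (toℕ r , e)
    ... | no none = no λ (r , e) → none (fromℕ< (m%n<n r (suc q)) , (begin
      (f ^ toℕ (fromℕ< (m%n<n r (suc q)))) s ≡⟨ ^-cong s (Fin.toℕ-fromℕ< (m%n<n r (suc q))) ⟩
      (f ^ (r % suc q)) s                    ≡⟨ ^-mod r ⟩
      (f ^ r) s                              ≡⟨ e ⟩
      t                                      ∎))

    -- (k + 1) * q ≡ -(k + 1) modulo the period q + 1.
    exponent : ℤ → ℕ
    exponent (+ k) = k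
    exponent -[1+ k ] = suc k * q

    orbitℤ : ℤ → A
    orbitℤ i = (f ^ exponent i) s

    orbitℤ-follows : Follows orbitℤ
    orbitℤ-follows (+ k) = ^-cong s (ℕ.+-comm k 1)
    orbitℤ-follows -[1+ zero ] = sym (^-period+ 0)
    orbitℤ-follows -[1+ suc k ] = sym (^-period+ (suc k * q))

    orbitℤ-periodic : ∀ i → orbitℤ (i +ℤ + suc q) ≡ orbitℤ i
    orbitℤ-periodic i = begin
      orbitℤ (i +ℤ + suc q)            ≡⟨ follows-^ orbitℤ-follows i (suc q) ⟩
      (f ^ suc q) ((f ^ exponent i) s) ≡⟨ ^-+ (suc q) (exponent i) s ⟨
      (f ^ (suc q + exponent i)) s     ≡⟨ ^-period+ (exponent i) ⟩
      orbitℤ i                         ∎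

  module Invariant {P : A → Set} (f-pres : ∀ {s} → P s → P (f s))
                   (f-inj : ∀ {s t} → P s → P t → f s ≡ f t → s ≡ t) where

    ^-pres : ∀ k {s} → P s → P ((f ^ k) s)
    ^-pres zero ps = ps
    ^-pres (suc k) ps = f-pres (^-pres k ps)

    ^-inj : ∀ k {s t} → P s → P t → (f ^ k) s ≡ (f ^ k) t → s ≡ t
    ^-inj zero _ _ e = e
    ^-inj (suc k) ps pt e = ^-inj k ps pt (f-inj (^-pres k ps) (^-pres k pt) e)

    periodic : ∀ {N} (enc : A → Fin N) → Injective _≡_ _≡_ enc →
               ∀ {s} → P s → ∃ λ q → (f ^ suc q) s ≡ s
    periodic {N} enc enc-inj {s} ps
      with i , j , i<j , e ← Fin.pigeonhole (ℕ.n<1+n N) (λ (i : Fin (suc N)) → enc ((f ^ toℕ i) s))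
      with q , i+q≡j ← ℕ.m≤n⇒∃[o]m+o≡n i<j
      = q , ^-inj (toℕ i) (^-pres (suc q) ps) ps (begin
        (f ^ toℕ i) ((f ^ suc q) s) ≡⟨ ^-+ (toℕ i) (suc q) s ⟨
        (f ^ (toℕ i + suc q)) s     ≡⟨ ^-cong s (ℕ.+-suc (toℕ i) q) ⟩
        (f ^ suc (toℕ i + q)) s     ≡⟨ ^-cong s i+q≡j ⟩
        (f ^ toℕ j) s               ≡⟨ enc-inj e ⟨
        (f ^ toℕ i) s               ∎)

    follows-agree : ∀ {X Y} → Follows X → Follows Y → (∀ i → P (X i)) → (∀ i → P (Y i)) →
                    ∀ {i j} → Y j ≡ X i → ∀ e → Y (j +ℤ e) ≡ X (i +ℤ e)
    follows-agree {X} {Y} fX fY pX pY {i} {j} e₀ = agree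
      where
      Agree : ℤ → Set
      Agree e = Y (j +ℤ e) ≡ X (i +ℤ e)

      shift : ∀ k e → k +ℤ (e +ℤ + 1) ≡ (k +ℤ e) +ℤ + 1
      shift k e = sym (ℤ.+-assoc k e (+ 1))

      forward : ∀ e → Agree e → Agree (e +ℤ + 1)
      forward e a = begin
        Y (j +ℤ (e +ℤ + 1)) ≡⟨ cong Y (shift j e) ⟩
        Y ((j +ℤ e) +ℤ + 1) ≡⟨ fY (j +ℤ e) ⟩
        f (Y (j +ℤ e))      ≡⟨ cong f a ⟩
        f (X (i +ℤ e))      ≡⟨ fX (i +ℤ e) ⟨
        X ((i +ℤ e) +ℤ + 1) ≡⟨ cong X (shift i e) ⟨
        X (i +ℤ (e +ℤ + 1)) ∎

      backward : ∀ e → Agree (e +ℤ + 1) → Agree e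
      backward e a = f-inj (pY (j +ℤ e)) (pX (i +ℤ e)) (begin
        f (Y (j +ℤ e))      ≡⟨ fY (j +ℤ e) ⟨
        Y ((j +ℤ e) +ℤ + 1) ≡⟨ cong Y (shift j e) ⟨
        Y (j +ℤ (e +ℤ + 1)) ≡⟨ a ⟩
        X (i +ℤ (e +ℤ + 1)) ≡⟨ cong X (shift i e) ⟩
        X ((i +ℤ e) +ℤ + 1) ≡⟨ fX (i +ℤ e) ⟩
        f (X (i +ℤ e))      ∎)

      agree₀ : Agree (+ 0)
      agree₀ = trans (cong Y (ℤ.+-identityʳ j)) (trans e₀ (cong X (sym (ℤ.+-identityʳ i))))

      agree : ∀ e → Agree e
      agree (+ zero) = agree₀
      agree (+ suc k) = subst Agree (cong +_ (ℕ.+-comm k 1)) (forward (+ k) (agree (+ k)))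
      agree -[1+ zero ] = backward -[1+ zero ] agree₀
      agree -[1+ suc k ] = backward -[1+ suc k ] (agree -[1+ k ])

module Triples {n m : ℕ} (face : FaceData n m) where

  Tri : Set
  Tri = Fin n × Fin n × Fin n

  ρ : Tri → Tri
  ρ (a , b , c) = c , b , a

  _∈₃_ : Fin n → Tri → Set
  v ∈₃ (a , b , c) = v ≡ a ⊎ v ≡ b ⊎ v ≡ c

  _∈ᶠ_ : Fin n → Fin m → Set
  v ∈ᶠ f = v ∈₃ face f

  Distinct : Tri → Set
  Distinct (a , b , c) = a ≢ b × b ≢ c × a ≢ c

  OnFace : Tri → Fin m → Set
  OnFace (a , b , c) f = a ∈ᶠ f × b ∈ᶠ f × c ∈ᶠ f

  -- t = (p, q, r) is one of the six orderings of the vertices of f, i.e. D_f (pq) = qr.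
  Ordering : Fin m → Tri → Set
  Ordering f (p , q , r) = D face f (p , q) (q , r)

  _∈₃?_ : ∀ v t → Dec (v ∈₃ t)
  v ∈₃? (a , b , c) = v Fin.≟ a ⊎-dec v Fin.≟ b ⊎-dec v Fin.≟ c

  module _ {v a b c : Fin n} where

    only-first : v ∈₃ (a , b , c) → v ≢ b → v ≢ c → v ≡ a
    only-first (inj₁ v≡a) _ _ = v≡a
    only-first (inj₂ (inj₁ v≡b)) v≢b _ = ⊥-elim (v≢b v≡b)
    only-first (inj₂ (inj₂ v≡c)) _ v≢c = ⊥-elim (v≢c v≡c)

    only-second : v ∈₃ (a , b , c) → v ≢ a → v ≢ c → v ≡ b
    only-second (inj₁ v≡a) v≢a _ = ⊥-elim (v≢a v≡a)
    only-second (inj₂ (inj₁ v≡b)) _ _ = v≡b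
    only-second (inj₂ (inj₂ v≡c)) _ v≢c = ⊥-elim (v≢c v≡c)

    only-third : v ∈₃ (a , b , c) → v ≢ a → v ≢ b → v ≡ c
    only-third (inj₁ v≡a) v≢a _ = ⊥-elim (v≢a v≡a)
    only-third (inj₂ (inj₁ v≡b)) _ v≢b = ⊥-elim (v≢b v≡b)
    only-third (inj₂ (inj₂ v≡c)) _ _ = v≡c

    ∉₃ : v ≢ a → v ≢ b → v ≢ c → ¬ v ∈₃ (a , b , c)
    ∉₃ v≢a _ _ (inj₁ v≡a) = v≢a v≡a
    ∉₃ _ v≢b _ (inj₂ (inj₁ v≡b)) = v≢b v≡b
    ∉₃ _ _ v≢c (inj₂ (inj₂ v≡c)) = v≢c v≡c

    ∈₃-rotate : v ∈₃ (a , b , c) → v ∈₃ (b , c , a)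
    ∈₃-rotate (inj₁ v≡a) = inj₂ (inj₂ v≡a)
    ∈₃-rotate (inj₂ (inj₁ v≡b)) = inj₁ v≡b
    ∈₃-rotate (inj₂ (inj₂ v≡c)) = inj₂ (inj₁ v≡c)

    ∈₃-reverse : v ∈₃ (a , b , c) → v ∈₃ (c , b , a)
    ∈₃-reverse (inj₁ v≡a) = inj₂ (inj₂ v≡a)
    ∈₃-reverse (inj₂ (inj₁ v≡b)) = inj₂ (inj₁ v≡b)
    ∈₃-reverse (inj₂ (inj₂ v≡c)) = inj₁ v≡c

  ∈₃-onFace : ∀ {t f v} → OnFace t f → v ∈₃ t → v ∈ᶠ f
  ∈₃-onFace (a∈ , _ , _) (inj₁ refl) = a∈
  ∈₃-onFace (_ , b∈ , _) (inj₂ (inj₁ refl)) = b∈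
  ∈₃-onFace (_ , _ , c∈) (inj₂ (inj₂ refl)) = c∈

  third-vertex : ∀ {f b c} → Distinct (face f) → b ∈ᶠ f → c ∈ᶠ f → b ≢ c →
                 ∃ λ d → d ∈ᶠ f × d ≢ b × d ≢ c
  third-vertex _ (inj₁ refl) (inj₁ refl) b≢c′ = ⊥-elim (b≢c′ refl)
  third-vertex (a≢b , b≢c , a≢c) (inj₁ refl) (inj₂ (inj₁ refl)) _ =
    _ , inj₂ (inj₂ refl) , ≢-sym a≢c , ≢-sym b≢c
  third-vertex (a≢b , b≢c , a≢c) (inj₁ refl) (inj₂ (inj₂ refl)) _ =
    _ , inj₂ (inj₁ refl) , ≢-sym a≢b , b≢c
  third-vertex (a≢b , b≢c , a≢c) (inj₂ (inj₁ refl)) (inj₁ refl) _ =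
    _ , inj₂ (inj₂ refl) , ≢-sym b≢c , ≢-sym a≢c
  third-vertex _ (inj₂ (inj₁ refl)) (inj₂ (inj₁ refl)) b≢c′ = ⊥-elim (b≢c′ refl)
  third-vertex (a≢b , b≢c , a≢c) (inj₂ (inj₁ refl)) (inj₂ (inj₂ refl)) _ =
    _ , inj₁ refl , a≢b , a≢c
  third-vertex (a≢b , b≢c , a≢c) (inj₂ (inj₂ refl)) (inj₁ refl) _ =
    _ , inj₂ (inj₁ refl) , b≢c , ≢-sym a≢b
  third-vertex (a≢b , b≢c , a≢c) (inj₂ (inj₂ refl)) (inj₂ (inj₁ refl)) _ =
    _ , inj₁ refl , a≢c , a≢b
  third-vertex _ (inj₂ (inj₂ refl)) (inj₂ (inj₂ refl)) b≢c′ = ⊥-elim (b≢c′ refl)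

  ordering-of-distinct : ∀ {f p q r} → Distinct (p , q , r) → OnFace (p , q , r) f →
                         Ordering f (p , q , r)
  ordering-of-distinct (p≢q , _ , _) (inj₁ refl , inj₁ refl , _) = ⊥-elim (p≢q refl)
  ordering-of-distinct (_ , q≢r , p≢r) (inj₁ refl , inj₂ (inj₁ refl) , r∈)
    with refl ← only-third r∈ (≢-sym p≢r) (≢-sym q≢r) = ab↦bc
  ordering-of-distinct (_ , q≢r , p≢r) (inj₁ refl , inj₂ (inj₂ refl) , r∈)
    with refl ← only-second r∈ (≢-sym p≢r) (≢-sym q≢r) = ac↦cb
  ordering-of-distinct (_ , q≢r , p≢r) (inj₂ (inj₁ refl) , inj₁ refl , r∈)
    with refl ← only-third r∈ (≢-sym q≢r) (≢-sym p≢r) = ba↦ac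
  ordering-of-distinct (p≢q , _ , _) (inj₂ (inj₁ refl) , inj₂ (inj₁ refl) , _) = ⊥-elim (p≢q refl)
  ordering-of-distinct (_ , q≢r , p≢r) (inj₂ (inj₁ refl) , inj₂ (inj₂ refl) , r∈)
    with refl ← only-first r∈ (≢-sym p≢r) (≢-sym q≢r) = bc↦ca
  ordering-of-distinct (_ , q≢r , p≢r) (inj₂ (inj₂ refl) , inj₁ refl , r∈)
    with refl ← only-second r∈ (≢-sym q≢r) (≢-sym p≢r) = ca↦ab
  ordering-of-distinct (_ , q≢r , p≢r) (inj₂ (inj₂ refl) , inj₂ (inj₁ refl) , r∈)
    with refl ← only-first r∈ (≢-sym q≢r) (≢-sym p≢r) = cb↦ba
  ordering-of-distinct (p≢q , _ , _) (inj₂ (inj₂ refl) , inj₂ (inj₂ refl) , _) = ⊥-elim (p≢q refl)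

  ordering-onFace : ∀ {f t} → Ordering f t → OnFace t f
  ordering-onFace ab↦bc = inj₁ refl , inj₂ (inj₁ refl) , inj₂ (inj₂ refl)
  ordering-onFace bc↦ca = inj₂ (inj₁ refl) , inj₂ (inj₂ refl) , inj₁ refl
  ordering-onFace ca↦ab = inj₂ (inj₂ refl) , inj₁ refl , inj₂ (inj₁ refl)
  ordering-onFace ac↦cb = inj₁ refl , inj₂ (inj₂ refl) , inj₂ (inj₁ refl)
  ordering-onFace cb↦ba = inj₂ (inj₂ refl) , inj₂ (inj₁ refl) , inj₁ refl
  ordering-onFace ba↦ac = inj₂ (inj₁ refl) , inj₁ refl , inj₂ (inj₂ refl)

  ordering-distinct : ∀ {f t} → Distinct (face f) → Ordering f t → Distinct t
  ordering-distinct (a≢b , b≢c , a≢c) ab↦bc = a≢b , b≢c , a≢c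
  ordering-distinct (a≢b , b≢c , a≢c) bc↦ca = b≢c , ≢-sym a≢c , ≢-sym a≢b
  ordering-distinct (a≢b , b≢c , a≢c) ca↦ab = ≢-sym a≢c , a≢b , ≢-sym b≢c
  ordering-distinct (a≢b , b≢c , a≢c) ac↦cb = a≢c , ≢-sym b≢c , a≢b
  ordering-distinct (a≢b , b≢c , a≢c) cb↦ba = ≢-sym b≢c , ≢-sym a≢b , ≢-sym a≢c
  ordering-distinct (a≢b , b≢c , a≢c) ba↦ac = ≢-sym a≢b , a≢c , b≢c

  ordering-complete : ∀ {f t v} → Ordering f t → v ∈ᶠ f → v ∈₃ t
  ordering-complete ab↦bc v∈ = v∈
  ordering-complete bc↦ca v∈ = ∈₃-rotate v∈
  ordering-complete ca↦ab v∈ = ∈₃-rotate (∈₃-rotate v∈)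
  ordering-complete ac↦cb v∈ = ∈₃-rotate (∈₃-rotate (∈₃-reverse v∈))
  ordering-complete cb↦ba v∈ = ∈₃-reverse v∈
  ordering-complete ba↦ac v∈ = ∈₃-rotate (∈₃-reverse v∈)

  ordering-ρ : ∀ {f t} → Ordering f t → Ordering f (ρ t)
  ordering-ρ ab↦bc = cb↦ba
  ordering-ρ bc↦ca = ac↦cb
  ordering-ρ ca↦ab = ba↦ac
  ordering-ρ ac↦cb = bc↦ca
  ordering-ρ cb↦ba = ab↦bc
  ordering-ρ ba↦ac = ca↦ab

  face-vertices : ∀ {t f v} → Distinct t → OnFace t f → v ∈ᶠ f → v ∈₃ t
  face-vertices d o = ordering-complete (ordering-of-distinct d o)

  HasEdge : Fin m → Fin n → Fin n → Set
  HasEdge f u v = u ∈ᶠ f × v ∈ᶠ f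

  onFace-edge₁₂ : ∀ {a b c f} → OnFace (a , b , c) f → HasEdge f a b
  onFace-edge₁₂ (a∈ , b∈ , _) = a∈ , b∈

  onFace-edge₂₃ : ∀ {a b c f} → OnFace (a , b , c) f → HasEdge f b c
  onFace-edge₂₃ (_ , b∈ , c∈) = b∈ , c∈

module Triangulated {n m : ℕ} {face : FaceData n m} (T : IsTriangulation face) where

  open IsTriangulation T
  open Triples face
  open ≡-Reasoning

  -- Nested like AdjacentAt, so that AdjacentAt x i is Flag (triple x i) by definition.
  Flag : Tri → Set
  Flag (a , b , c) = a ≢ b × b ≢ c × a ≢ c × ∃ (OnFace (a , b , c))

  Flag? : ∀ t → Dec (Flag t)
  Flag? (a , b , c) =
    ¬? (a Fin.≟ b) ×-dec ¬? (b Fin.≟ c) ×-dec ¬? (a Fin.≟ c) ×-dec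
    Fin.any? (λ f → (a ∈₃? face f) ×-dec (b ∈₃? face f) ×-dec (c ∈₃? face f))

  flag-distinct : ∀ {t} → Flag t → Distinct t
  flag-distinct (a≢b , b≢c , a≢c , _) = a≢b , b≢c , a≢c

  ρ-flag : ∀ {t} → Flag t → Flag (ρ t)
  ρ-flag (a≢b , b≢c , a≢c , f , a∈ , b∈ , c∈) =
    ≢-sym b≢c , ≢-sym a≢b , ≢-sym a≢c , f , c∈ , b∈ , a∈

  ordering-flag : ∀ {f t} → Ordering f t → Flag t
  ordering-flag {f} o with p≢q , q≢r , p≢r ← ordering-distinct (faceDistinctVertices f) o
    = p≢q , q≢r , p≢r , f , ordering-onFace o

  onFace-unique : ∀ {t f g} → Distinct t → OnFace t f → OnFace t g → f ≡ g
  onFace-unique d of og = facesDetermined _ _ λ v v∈f → ∈₃-onFace og (face-vertices d of v∈f)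

  two-faces-per-edge : ∀ {u v f g h} → u ≢ v → HasEdge f u v → HasEdge g u v → HasEdge h u v →
                       f ≡ g ⊎ g ≡ h ⊎ f ≡ h
  two-faces-per-edge u≢v (u∈f , v∈f) (u∈g , v∈g) (u∈h , v∈h)
    with _ , _ , _ , _ , _ , only ← edgeInTwoFaces _ _ (u≢v , _ , u∈f , v∈f)
    = two-valued-pigeonhole (only _ u∈f v∈f) (only _ u∈g v∈g) (only _ u∈h v∈h)

  other-face : ∀ {u v f} → u ≢ v → HasEdge f u v → ∃ λ g → g ≢ f × HasEdge g u v
  other-face u≢v (u∈f , v∈f)
    with f₁ , g₁ , f₁≢g₁ , e₁ , e₂ , only ← edgeInTwoFaces _ _ (u≢v , _ , u∈f , v∈f)
    with only _ u∈f v∈f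
  ... | inj₁ refl = g₁ , ≢-sym f₁≢g₁ , e₂
  ... | inj₂ refl = f₁ , f₁≢g₁ , e₁

  Continuation : Tri → Fin n → Set
  Continuation (a , b , c) d = Flag (b , c , d) × d ≢ a

  Continuation? : ∀ t d → Dec (Continuation t d)
  Continuation? (a , b , c) d = Flag? (b , c , d) ×-dec ¬? (d Fin.≟ a)

  continuation-new-face : ∀ {a b c d f g} → Flag (a , b , c) → OnFace (a , b , c) f →
                          Continuation (a , b , c) d → OnFace (b , c , d) g → g ≢ f
  continuation-new-face fl of ((_ , c≢d , b≢d , _) , d≢a) (_ , _ , d∈g) refl =
    ∉₃ d≢a (≢-sym b≢d) (≢-sym c≢d) (face-vertices (flag-distinct fl) of d∈g)

  continuation-exists : ∀ {t} → Flag t → ∃ (Continuation t)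
  continuation-exists fl@(_ , b≢c , _ , f , a∈f , b∈f , c∈f)
    with g , g≢f , b∈g , c∈g ← other-face b≢c (b∈f , c∈f)
    with d , d∈g , d≢b , d≢c ← third-vertex (faceDistinctVertices g) b∈g c∈g b≢c
    = d , (b≢c , ≢-sym d≢c , ≢-sym d≢b , g , b∈g , c∈g , d∈g) , λ where
        refl → g≢f (onFace-unique (flag-distinct fl) (d∈g , b∈g , c∈g) (a∈f , b∈f , c∈f))

  continuation-unique : ∀ {t d d′} → Flag t → Continuation t d → Continuation t d′ → d ≡ d′
  continuation-unique fl@(_ , b≢c , _ , f , of) κ@((_ , c≢d , b≢d , g , og) , _)
                      κ′@((_ , c≢d′ , b≢d′ , g′ , og′) , _)
    with two-faces-per-edge b≢c (onFace-edge₂₃ of) (onFace-edge₁₂ og) (onFace-edge₁₂ og′)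
  ... | inj₁ f≡g = contradiction (sym f≡g) (continuation-new-face fl of κ og)
  ... | inj₂ (inj₂ f≡g′) = contradiction (sym f≡g′) (continuation-new-face fl of κ′ og′)
  ... | inj₂ (inj₁ refl) =
    sym (only-third (face-vertices (b≢c , c≢d , b≢d) og (proj₂ (proj₂ og′)))
                    (≢-sym b≢d′) (≢-sym c≢d′))

  -- Off flags next returns the junk value proj₁ t. Opaque, so that unification never
  -- unfolds the search.
  opaque
    next : Tri → Fin n
    next t with Fin.any? (Continuation? t)
    ... | yes (d , _) = d
    ... | no _ = proj₁ t

    next-continuation : ∀ {t} → Flag t → Continuation t (next t)
    next-continuation {t} fl with Fin.any? (Continuation? t)
    ... | yes (_ , κ) = κ
    ... | no none = contradiction (continuation-exists fl) none

  σ : Tri → Tri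
  σ (a , b , c) = b , c , next (a , b , c)

  σ-flag : ∀ {t} → Flag t → Flag (σ t)
  σ-flag fl = proj₁ (next-continuation fl)

  σ-new-face : ∀ {t f g} → Flag t → OnFace t f → OnFace (σ t) g → f ≢ g
  σ-new-face fl of og = ≢-sym (continuation-new-face fl of (next-continuation fl) og)

  σ-of-continuation : ∀ {a b c d} → Flag (a , b , c) → Continuation (a , b , c) d →
                      σ (a , b , c) ≡ (b , c , d)
  σ-of-continuation fl κ = cong (λ e → _ , _ , e) (continuation-unique fl (next-continuation fl) κ)

  σ-of-turn : ∀ {a b c d} → Flag (a , b , c) → Flag (b , c , d) →
              (∀ f g → OnFace (a , b , c) f → OnFace (b , c , d) g → f ≢ g) →
              σ (a , b , c) ≡ (b , c , d)
  σ-of-turn fl@(_ , _ , _ , f , a∈f , b∈f , c∈f) fl′ separated =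
    σ-of-continuation fl (fl′ , λ where
      refl → separated f f (a∈f , b∈f , c∈f) (b∈f , c∈f , a∈f) refl)

  σρσ : ∀ {t} → Flag t → σ (ρ (σ t)) ≡ ρ t
  σρσ fl with fl′ , d≢a ← next-continuation fl
    = σ-of-continuation (ρ-flag fl′) (ρ-flag fl , ≢-sym d≢a)

  σ-injective : ∀ {t u} → Flag t → Flag u → σ t ≡ σ u → t ≡ u
  σ-injective {t} {u} ft fu e = cong ρ (begin
    ρ t         ≡⟨ σρσ ft ⟨
    σ (ρ (σ t)) ≡⟨ cong (σ ∘ ρ) e ⟩
    σ (ρ (σ u)) ≡⟨ σρσ fu ⟩
    ρ u         ∎)

  encode : Tri → Fin (n * (n * n))
  encode (a , b , c) = combine a (combine b c)

  encode-injective : Injective _≡_ _≡_ encode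
  encode-injective {a , b , c} {a′ , b′ , c′} e
    with refl , e′ ← Fin.combine-injective a (combine b c) a′ (combine b′ c′) e
    with refl , refl ← Fin.combine-injective b c b′ c′ e′
    = refl

  open Iteration σ
  open Invariant σ-flag σ-injective

  period : ∀ {s} → Flag s → ∃ λ q → (σ ^ suc q) s ≡ s
  period = periodic encode encode-injective

  module FlagOrbit {s} (fl : Flag s) = Periodic {s} {proj₁ (period fl)} (proj₂ (period fl))

  σ^ρσ^ : ∀ j {t} → Flag t → (σ ^ j) (ρ ((σ ^ j) t)) ≡ ρ t
  σ^ρσ^ zero _ = refl
  σ^ρσ^ (suc j) {t} fl = begin
    (σ ^ suc j) (ρ (σ ((σ ^ j) t)))   ≡⟨ ^-cong _ (ℕ.+-comm 1 j) ⟩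
    (σ ^ (j + 1)) (ρ (σ ((σ ^ j) t))) ≡⟨ ^-+ j 1 _ ⟩
    (σ ^ j) (σ (ρ (σ ((σ ^ j) t))))   ≡⟨ cong (σ ^ j) (σρσ (^-pres j fl)) ⟩
    (σ ^ j) (ρ ((σ ^ j) t))           ≡⟨ σ^ρσ^ j fl ⟩
    ρ t                               ∎

  ρ-midpoint : ∀ {s} → Flag s → ∀ j k → (σ ^ (j + k)) s ≡ ρ s → (σ ^ k) s ≡ ρ ((σ ^ j) s)
  ρ-midpoint {s} fl j k e = ^-inj j (^-pres k fl) (ρ-flag (^-pres j fl)) (begin
    (σ ^ j) ((σ ^ k) s)     ≡⟨ ^-+ j k s ⟨
    (σ ^ (j + k)) s         ≡⟨ e ⟩
    ρ s                     ≡⟨ σ^ρσ^ j fl ⟨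
    (σ ^ j) (ρ ((σ ^ j) s)) ∎)

  halve : ∀ r → ∃ λ j → r ≡ j + j ⊎ r ≡ j + suc j
  halve zero = 0 , inj₁ refl
  halve (suc r) with halve r
  ... | j , inj₁ refl = j , inj₂ (sym (ℕ.+-suc j j))
  ... | j , inj₂ refl = suc j , inj₁ refl

  orbit-avoids-reverse : ∀ {s} → Flag s → ¬ Reach s (ρ s)
  orbit-avoids-reverse {s} fl (r , σʳs≡ρs) with halve r
  ... | j , inj₁ refl = a≢c (cong proj₁ (ρ-midpoint fl j j σʳs≡ρs))
    where a≢c = proj₁ (proj₂ (proj₂ (^-pres j fl)))
  ... | j , inj₂ refl = b≢c (cong proj₁ (ρ-midpoint fl j (suc j) σʳs≡ρs))
    where b≢c = proj₁ (proj₂ (^-pres j fl))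

  triple : (ℤ → Fin n) → ℤ → Tri
  triple x i = x i , x (i +ℤ + 1) , x (i +ℤ + 2)

  zigzag-flag : ∀ {x} → IsZigzag face x → ∀ i → Flag (triple x i)
  zigzag-flag (_ , adjacent , _) = adjacent

  zigzag-follows : ∀ {x} → IsZigzag face x → Follows (triple x)
  zigzag-follows {x} (_ , adjacent , separated) i = begin
    triple x (i +ℤ + 1)                                   ≡⟨ shifted ⟩
    (x (i +ℤ + 1) , x (i +ℤ + 2) , x ((i +ℤ + 1) +ℤ + 2)) ≡⟨ σ-of-turn (adjacent i)
                                                              (subst Flag shifted (adjacent (i +ℤ + 1)))
                                                              separated′ ⟨
    σ (triple x i)                                        ∎
    where
    shifted : triple x (i +ℤ + 1) ≡ (x (i +ℤ + 1) , x (i +ℤ + 2) , x ((i +ℤ + 1) +ℤ + 2))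
    shifted = cong (λ e → x (i +ℤ + 1) , x e , x ((i +ℤ + 1) +ℤ + 2)) (ℤ.+-assoc i (+ 1) (+ 1))
    separated′ : ∀ f g → OnFace (triple x i) f →
                 OnFace (x (i +ℤ + 1) , x (i +ℤ + 2) , x ((i +ℤ + 1) +ℤ + 2)) g → f ≢ g
    separated′ f g of og = separated i f g of (subst (λ t → OnFace t g) (sym shifted) og)

  triple-proj₁ : ∀ {X} → Follows X → ∀ i → triple (proj₁ ∘ X) i ≡ X i
  triple-proj₁ {X} follows i = cong₂ (λ b c → proj₁ (X i) , b , c) (cong proj₁ (follows i)) (begin
    proj₁ (X (i +ℤ + 2))          ≡⟨ cong (proj₁ ∘ X) (ℤ.+-assoc i (+ 1) (+ 1)) ⟨
    proj₁ (X ((i +ℤ + 1) +ℤ + 1)) ≡⟨ cong proj₁ (follows (i +ℤ + 1)) ⟩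
    proj₁ (σ (X (i +ℤ + 1)))      ≡⟨ cong (proj₁ ∘ σ) (follows i) ⟩
    proj₁ (σ (σ (X i)))           ∎)

  zigzag-of-flags : ∀ {X} → Follows X → (∀ i → Flag (X i)) →
                    (∃ λ p → ∀ i → X (i +ℤ + suc p) ≡ X i) → IsZigzag face (proj₁ ∘ X)
  zigzag-of-flags {X} follows flag (p , periodic) =
      (p , λ i → cong proj₁ (periodic i))
    , (λ i → subst Flag (sym (triple-proj₁ follows i)) (flag i))
    , λ i f g of og → σ-new-face (flag i)
        (subst (λ t → OnFace t f) (triple-proj₁ follows i) of)
        (subst (λ t → OnFace t g) (trans (triple-proj₁ follows (i +ℤ + 1)) (follows i)) og)

  module _ {s : Tri} (fl : Flag s) where

    open FlagOrbit fl

    zigzagFrom : ℤ → Fin n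
    zigzagFrom = proj₁ ∘ orbitℤ

    triple-zigzagFrom : ∀ i → triple zigzagFrom i ≡ orbitℤ i
    triple-zigzagFrom = triple-proj₁ orbitℤ-follows

    zigzagFrom-isZigzag : IsZigzag face zigzagFrom
    zigzagFrom-isZigzag = zigzag-of-flags orbitℤ-follows (λ i → ^-pres (exponent i) fl)
                                          (proj₁ (period fl) , orbitℤ-periodic)

    reach-zigzagFrom : ∀ i → Reach s (triple zigzagFrom i)
    reach-zigzagFrom i = exponent i , sym (triple-zigzagFrom i)

  sameZigzag-of-triple : ∀ {x y i j} → IsZigzag face x → IsZigzag face y →
                         triple y j ≡ triple x i → SameZigzag face x y
  sameZigzag-of-triple {x} {y} {i} {j} zx zy e = i +ℤ - j , λ u → begin
    y u                 ≡⟨ cong y (u≡j+[u-j] j u) ⟩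
    y (j +ℤ (u +ℤ - j)) ≡⟨ cong proj₁ (follows-agree (zigzag-follows zx) (zigzag-follows zy)
                                         (zigzag-flag zx) (zigzag-flag zy) e (u +ℤ - j)) ⟩
    x (i +ℤ (u +ℤ - j)) ≡⟨ cong x (i+[u-j]≡u+[i-j] i j u) ⟩
    x (u +ℤ (i +ℤ - j)) ∎
    where
    u≡j+[u-j] : ∀ j u → u ≡ j +ℤ (u +ℤ - j)
    u≡j+[u-j] = solve-∀
    i+[u-j]≡u+[i-j] : ∀ i j u → i +ℤ (u +ℤ - j) ≡ u +ℤ (i +ℤ - j)
    i+[u-j]≡u+[i-j] = solve-∀

  triple-shift : ∀ {x y k} → (∀ u → y u ≡ x (u +ℤ k)) → ∀ i → triple y i ≡ triple x (i +ℤ k)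
  triple-shift {x} {y} {k} same i =
    cong₂ _,_ (same i) (cong₂ _,_ (trans (same (i +ℤ + 1)) (cong x (comm₁ i k)))
                                  (trans (same (i +ℤ + 2)) (cong x (comm₂ i k))))
    where
    comm₁ : ∀ i k → (i +ℤ + 1) +ℤ k ≡ (i +ℤ k) +ℤ + 1
    comm₁ = solve-∀
    comm₂ : ∀ i k → (i +ℤ + 2) +ℤ k ≡ (i +ℤ k) +ℤ + 2
    comm₂ = solve-∀

  reach-of-sameZigzag : ∀ {s t} (fs : Flag s) (ft : Flag t) →
                        SameZigzag face (zigzagFrom fs) (zigzagFrom ft) → Reach s t
  reach-of-sameZigzag fs ft (k , same) =
    Reach-trans (reach-zigzagFrom fs (+ 0 +ℤ k))
                (0 , sym (triple-shift {zigzagFrom fs} {zigzagFrom ft} {k} same (+ 0)))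

  ordering⇒InZ : ∀ {F x} i → Ordering F (triple x i) → InZ face F x
  ordering⇒InZ i o =
    i , (proj₁ (ordering-onFace o) , proj₁ (proj₂ (ordering-onFace o)) , proj₁ (ordering-flag o)) , o

  edge-ordering : ∀ {F t p q r} → Flag t → σ t ≡ (p , q , r) → HasEdge F p q →
                  Ordering F t ⊎ Ordering F (p , q , r)
  edge-ordering fl@(_ , p≢q , _ , f , of) refl pq∈F
    with fl′@(_ , _ , _ , g , og) ← σ-flag fl
    with two-faces-per-edge p≢q pq∈F (onFace-edge₂₃ of) (onFace-edge₁₂ og)
  ... | inj₁ refl = inj₁ (ordering-of-distinct (flag-distinct fl) of)
  ... | inj₂ (inj₁ f≡g) = contradiction f≡g (σ-new-face fl of og)
  ... | inj₂ (inj₂ refl) = inj₂ (ordering-of-distinct (flag-distinct fl′) og)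

  zigzag-step-into : ∀ {x} → IsZigzag face x → ∀ i → σ (triple x (i +ℤ -[1+ 0 ])) ≡ triple x i
  zigzag-step-into {x} zx i = trans (sym (zigzag-follows zx (i +ℤ -[1+ 0 ]))) (cong (triple x) (i-1+1≡i i))
    where
    i-1+1≡i : ∀ i → (i +ℤ -[1+ 0 ]) +ℤ + 1 ≡ i
    i-1+1≡i = solve-∀

  InZ⇔ContainsEdgeOf : ∀ {F x} → IsZigzag face x → InZ face F x ⇔ ContainsEdgeOf face F x
  InZ⇔ContainsEdgeOf {F} {x} zx = mk⇔ (λ (i , ω , _) → i , ω) edge⇒InZ
    where
    edge⇒InZ : ContainsEdgeOf face F x → InZ face F x
    edge⇒InZ (i , p∈F , q∈F , _)
      with edge-ordering (zigzag-flag zx (i +ℤ -[1+ 0 ])) (zigzag-step-into zx i) (p∈F , q∈F)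
    ... | inj₁ o = ordering⇒InZ (i +ℤ -[1+ 0 ]) o
    ... | inj₂ o = ordering⇒InZ i o

  triple-rev : ∀ x i → triple (rev face x) (- (i +ℤ + 2)) ≡ ρ (triple x i)
  triple-rev x i = cong₂ _,_ (cong x (e₀ i)) (cong₂ _,_ (cong x (e₁ i)) (cong x (e₂ i)))
    where
    e₀ : ∀ i → - (- (i +ℤ + 2)) ≡ i +ℤ + 2
    e₀ = solve-∀
    e₁ : ∀ i → - (- (i +ℤ + 2) +ℤ + 1) ≡ i +ℤ + 1
    e₁ = solve-∀
    e₂ : ∀ i → - (- (i +ℤ + 2) +ℤ + 2) ≡ i
    e₂ = solve-∀

  InZ-rev : ∀ {F x} → InZ face F x → InZ face F (rev face x)
  InZ-rev {F} {x} (i , _ , o) = ordering⇒InZ _ (subst (Ordering F) (sym (triple-rev x i)) (ordering-ρ o))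

  module FaceOrbits (F : Fin m) where

    FaceOrdering : Set
    FaceOrdering = Σ Tri (Ordering F)

    orbit-decSetoid : DecSetoid _ _
    orbit-decSetoid = record
      { Carrier = FaceOrdering
      ; _≈_ = λ (s , _) (t , _) → Reach s t
      ; isDecEquivalence = record
        { isEquivalence = record
          { refl = Reach-refl
          ; sym = λ {(_ , o)} → FlagOrbit.Reach-sym (ordering-flag o)
          ; trans = Reach-trans
          }
        ; _≟_ = λ (_ , o) (t , _) → FlagOrbit.Reach? (ordering-flag o) ≡-dec-Tri t
        }
      }
      where
      ≡-dec-Tri : DecidableEquality Tri
      ≡-dec-Tri = Product.≡-dec Fin._≟_ (Product.≡-dec Fin._≟_ Fin._≟_)

    open DecSetoid orbit-decSetoid using (_≈_; _≟_; setoid) renaming (sym to ≈-sym; trans to ≈-trans)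
    open import Data.List.Membership.Setoid setoid using (_∈_)
    open import Data.List.Membership.Setoid.Properties using (∈-deduplicate⁺)
    open import Data.List.Relation.Unary.Unique.DecSetoid.Properties using (deduplicate-!)

    orderings : List FaceOrdering
    orderings =
      (_ , ab↦bc) ∷ (_ , bc↦ca) ∷ (_ , ca↦ab) ∷ (_ , ac↦cb) ∷ (_ , cb↦ba) ∷ (_ , ba↦ac) ∷ []

    ∈-orderings : ∀ o → o ∈ orderings
    ∈-orderings (_ , ab↦bc) = here Reach-refl
    ∈-orderings (_ , bc↦ca) = there (here Reach-refl)
    ∈-orderings (_ , ca↦ab) = there (there (here Reach-refl))
    ∈-orderings (_ , ac↦cb) = there (there (there (here Reach-refl)))
    ∈-orderings (_ , cb↦ba) = there (there (there (there (here Reach-refl))))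
    ∈-orderings (_ , ba↦ac) = there (there (there (there (there (here Reach-refl)))))

    representatives : List FaceOrdering
    representatives = deduplicate _≟_ orderings

    count : ℕ
    count = length representatives

    representative : Fin count → FaceOrdering
    representative = lookup representatives

    representative-flag : ∀ j → Flag (proj₁ (representative j))
    representative-flag j = ordering-flag (proj₂ (representative j))

    represented : ∀ o → ∃ λ j → o ≈ representative j
    represented o = index o∈ , lookup-index o∈
      where
      o∈ : o ∈ representatives
      o∈ = ∈-deduplicate⁺ setoid {R = _≈_} _≟_
             (λ {x} {y} {z} z≈y x≈y → ≈-trans {x} {y} {z} x≈y (≈-sym {z} {y} z≈y))
             {orderings} {o} (∈-orderings o)

    zigzag : Fin count → ℤ → Fin n
    zigzag j = zigzagFrom (representative-flag j)

    zigzag-inZ : ∀ j → IsZigzag face (zigzag j) × InZ face F (zigzag j)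
    zigzag-inZ j = zigzagFrom-isZigzag (representative-flag j) , ordering⇒InZ (+ 0)
      (subst (Ordering F) (sym (triple-zigzagFrom (representative-flag j) (+ 0))) (proj₂ (representative j)))

    zigzag-injective : ∀ j j′ → SameZigzag face (zigzag j) (zigzag j′) → j ≡ j′
    zigzag-injective j j′ same =
      Unique⇒lookup-injective setoid (deduplicate-! orbit-decSetoid orderings) j j′
        (reach-of-sameZigzag (representative-flag j) (representative-flag j′) same)

    zigzag-covers : ∀ x → IsZigzag face x → InZ face F x → ∃ λ j → SameZigzag face x (zigzag j)
    zigzag-covers x zx (i , _ , o) = covers (represented (triple x i , o))
      where
      covers : (∃ λ j → (triple x i , o) ≈ representative j) → ∃ λ j → SameZigzag face x (zigzag j)
      covers (j , r , σʳt≡rep) =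
        j , sameZigzag-of-triple {x} {zigzag j} {i +ℤ + r} {+ 0} zx
              (zigzagFrom-isZigzag (representative-flag j)) (begin
          triple (zigzag j) (+ 0)  ≡⟨ triple-zigzagFrom (representative-flag j) (+ 0) ⟩
          proj₁ (representative j) ≡⟨ σʳt≡rep ⟨
          (σ ^ r) (triple x i)     ≡⟨ follows-^ (zigzag-follows zx) i r ⟨
          triple x (i +ℤ + r)      ∎)

    two≤count : 2 ≤ count
    two≤count = apart (represented abc) (represented cba)
      where
      abc cba : FaceOrdering
      abc = _ , ab↦bc
      cba = _ , cb↦ba
      apart : (∃ λ j → abc ≈ representative j) → (∃ λ j → cba ≈ representative j) →
              2 ≤ count
      apart (j₀ , abc≈) (j₁ , cba≈) = distinct-indices⇒2≤ j₀ j₁ λ where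
        refl → orbit-avoids-reverse (ordering-flag ab↦bc)
                 (≈-trans {abc} {representative j₀} {cba} abc≈
                          (≈-sym {cba} {representative j₀} cba≈))

    count≤6 : count ≤ 6
    count≤6 = length-deduplicate _≟_ orderings

lemma2 : ∀ {n m} (face : FaceData n m) → IsTriangulation face → (F : Fin m) →
    ((x : ℤ → Fin n) → IsZigzag face x → (InZ face F x ⇔ ContainsEdgeOf face F x))
    × ((x : ℤ → Fin n) → IsZigzag face x → InZ face F x → InZ face F (rev face x))
    × (∃ λ (k : ℕ) → ∃ λ (zs : Fin k → (ℤ → Fin n)) →
         (∀ j → IsZigzag face (zs j) × InZ face F (zs j))
         × (∀ j j′ → SameZigzag face (zs j) (zs j′) → j ≡ j′)
         × (∀ x → IsZigzag face x → InZ face F x → ∃ λ j → SameZigzag face x (zs j))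
         × 2 ≤ k × k ≤ 6)
lemma2 face T F =
    (λ _ → InZ⇔ContainsEdgeOf)
  , (λ _ _ → InZ-rev)
  , count , zigzag , zigzag-inZ , zigzag-injective , zigzag-covers , two≤count , count≤6
  where
  open Triangulated T
  open FaceOrbits F
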